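{- Let $d\ge 3$ be an integer and let $x,y$ be integers satisfying \[ d(2x+d+1)\left(x^2+(d+1)x+\frac{d(d+1)}{2}\right)=2y^3. \] Then there exist integers $y_1,y_2$ and a pair $(\alpha,\beta)\in\mathcal{A}_d$ such that \[ 2x+d+1=\alpha y_1^3,\qquad x^2+(d+1)x+\frac{d(d+1)}{2}=\beta y_2^3. \]
   Context: For an integer $m$, $[m]\in\{0,1,2\}$ denotes the residue of $m$ modulo $3$. For a prime $q$ let $\mu_q=\mathrm{ord}_q(d^2-1)$ and $\nu_q=\mathrm{ord}_q(d)$. For each prime $q$ define $T_q\subset\{0,1,2\}^2$: if $q\nmid d(d^2-1)$, $T_q=\{(0,0)\}$. For $q=2$: if $2\mid d$, $T_2=\{(0,[1-\nu_2])\}$; if $2\nmid d$ and $\mu_2\ge 4$, $T_2=\{(1,0),(0,1),(2,2)\}$; if $2\nmid d$ and $\mu_2=3$, $T_2=\{(1,0),(0,1)\}$. For odd $q\mid d$: $T_q=\{([-\nu_q],0),(0,[-\nu_q])\}$. For odd $q\mid d^2-1$: if $\mu_q\ge 2$, $T_q=\{(0,0),(1,2),(2,1)\}$; if $\mu_q=1$, $T_q=\{(0,0),(2,1)\}$. Here $\mathcal{A}_d$ is the set of pairs of positive integers $(\alpha,\beta)$ with $(\mathrm{ord}_q(\alpha),\mathrm{ord}_q(\beta))\in T_q$ for all primes $q$. -}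

module Defs where

open import Data.Nat as ℕ using (ℕ; suc; _≤_; _<_; _%_; _/_)
open import Data.Nat.Divisibility using (_∣_)
open import Data.Nat.Primality using (Prime)
open import Data.Integer as ℤ using (ℤ; +_)
open import Data.Product using (_×_; ∃)
open import Data.Sum using (_⊎_)
open import Relation.Nullary using (¬_)
open import Relation.Binary.PropositionalEquality using (_≡_; _≢_)

-- q-adic valuation as a relation: ord_q(n) = k  iff  q^k ∣ n and q^(k+1) ∤ n
-- (for n > 0 and q prime, such k exists and is unique)
HasOrd : ℕ → ℕ → ℕ → Set
HasOrd q n k = (q ℕ.^ k ∣ n) × ¬ (q ℕ.^ suc k ∣ n)

dsq-1 : ℕ → ℕ
dsq-1 d = d ℕ.* d ℕ.∸ 1

-- residue [-ν] mod 3, written as (2ν) mod 3; [1-ν] as (1 + 2ν) mod 3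
neg3 : ℕ → ℕ
neg3 ν = (2 ℕ.* ν) % 3

InT : (d q r s : ℕ) → Set
InT d q r s =
    ((¬ (q ∣ d ℕ.* dsq-1 d)) × r ≡ 0 × s ≡ 0)
  ⊎ (q ≡ 2 × (2 ∣ d) × ∃ λ ν → HasOrd 2 d ν × r ≡ 0 × s ≡ (1 ℕ.+ 2 ℕ.* ν) % 3)
  ⊎ (q ≡ 2 × ¬ (2 ∣ d) × ∃ λ μ → HasOrd 2 (dsq-1 d) μ × 4 ≤ μ ×
        ((r ≡ 1 × s ≡ 0) ⊎ (r ≡ 0 × s ≡ 1) ⊎ (r ≡ 2 × s ≡ 2)))
  ⊎ (q ≡ 2 × ¬ (2 ∣ d) × HasOrd 2 (dsq-1 d) 3 ×
        ((r ≡ 1 × s ≡ 0) ⊎ (r ≡ 0 × s ≡ 1)))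
  ⊎ (q ≢ 2 × (q ∣ d) × ∃ λ ν → HasOrd q d ν ×
        ((r ≡ neg3 ν × s ≡ 0) ⊎ (r ≡ 0 × s ≡ neg3 ν)))
  ⊎ (q ≢ 2 × (q ∣ dsq-1 d) × ∃ λ μ → HasOrd q (dsq-1 d) μ × 2 ≤ μ ×
        ((r ≡ 0 × s ≡ 0) ⊎ (r ≡ 1 × s ≡ 2) ⊎ (r ≡ 2 × s ≡ 1)))
  ⊎ (q ≢ 2 × HasOrd q (dsq-1 d) 1 ×
        ((r ≡ 0 × s ≡ 0) ⊎ (r ≡ 2 × s ≡ 1)))

InA : (d α β : ℕ) → Set
InA d α β = 0 < α × 0 < β ×
  (∀ q → Prime q → ∀ a b → HasOrd q α a → HasOrd q β b → InT d q (a % 3) (b % 3))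

L : ℕ → ℤ → ℤ
L d x = + 2 ℤ.* x ℤ.+ + d ℤ.+ + 1

-- x² + (d+1)x + d(d+1)/2   (d(d+1) is even, so the division is exact)
Q : ℕ → ℤ → ℤ
Q d x = x ℤ.* x ℤ.+ + (d ℕ.+ 1) ℤ.* x ℤ.+ + ((d ℕ.* (d ℕ.+ 1)) / 2)

{-# OPTIONS --safe #-}
module Submission where

-- Put D = d² − 1. Completing the square gives 4Q = L² + D, so Q is a positive integer and we
-- can take β = Q, y₂ = 1, α = |L|, y₁ = ±1 (if L = 0 then y₁ = 0 and α is free). As 𝒜_d only
-- constrains valuations modulo 3, what remains is (|L|, Q) ∈ 𝒜_d. For a prime q, dLQ = 2y³ gives
--   ord_q d + ord_q L + ord_q Q ≡ ord_q 2 (mod 3);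
-- a common prime factor of L and Q divides D, hence not d; and if q ∣ L then 4Q = L² + D forces
-- ord_q Q = ord_q D − ord_q 4 whenever ord_q D is small (ord_q D = 1 for odd q, ord₂ D = 3
-- with 4 ∣ L), which excludes one residue pair. With 8 ∣ D for odd d, a case analysis on q
-- according to whether it divides d, D or neither yields exactly T_q.

module Valuation where

  open import Defs
  open import Data.Nat
  open import Data.Nat.Properties
  open import Data.Nat.Divisibility
  open import Data.Nat.Primality
  open import Data.Nat.Induction using (<-wellFounded)
  open import Induction.WellFounded using (Acc; acc)
  open import Data.Product
  open import Data.Sum using (inj₁; inj₂)
  open import Relation.Nullary using (¬_; yes; no; contradiction)
  open import Relation.Binary.PropositionalEquality
  open import Relation.Binary.Definitions using (tri<; tri≈; tri>)
  open import Algebra.Properties.CommutativeSemigroup *-commutativeSemigroup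
    using () renaming (interchange to *-interchange)

  ^-monoʳ-∣ : ∀ q {m n} → m ≤ n → q ^ m ∣ q ^ n
  ^-monoʳ-∣ q {n = n} z≤n       = 1∣ (q ^ n)
  ^-monoʳ-∣ q         (s≤s m≤n) = *-monoʳ-∣ q (^-monoʳ-∣ q m≤n)

  hasOrd-unique : ∀ {q n a b} → HasOrd q n a → HasOrd q n b → a ≡ b
  hasOrd-unique {q} {n} {a} {b} (qᵃ∣n , qᵃ⁺¹∤n) (qᵇ∣n , qᵇ⁺¹∤n) with <-cmp a b
  ... | tri< a<b _ _ = contradiction (∣-trans (^-monoʳ-∣ q a<b) qᵇ∣n) qᵃ⁺¹∤n
  ... | tri≈ _ a≡b _ = a≡b
  ... | tri> _ _ b<a = contradiction (∣-trans (^-monoʳ-∣ q b<a) qᵃ∣n) qᵇ⁺¹∤n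

  ∤⇒hasOrd-0 : ∀ {q n} → ¬ q ∣ n → HasOrd q n 0
  ∤⇒hasOrd-0 {q} {n} q∤n = 1∣ n , λ q¹∣n → q∤n (subst (_∣ n) (*-identityʳ q) q¹∣n)

  ^∣⇒≤hasOrd : ∀ {q n μ k} → HasOrd q n μ → q ^ k ∣ n → k ≤ μ
  ^∣⇒≤hasOrd {q} {μ = μ} {k} (_ , qᵘ⁺¹∤n) qᵏ∣n with k ≤? μ
  ... | yes k≤μ = k≤μ
  ... | no k≰μ  = contradiction (∣-trans (^-monoʳ-∣ q (≰⇒> k≰μ)) qᵏ∣n) qᵘ⁺¹∤n

  hasOrd⇒^∣ : ∀ {q n μ k} → HasOrd q n μ → k ≤ μ → q ^ k ∣ n
  hasOrd⇒^∣ {q} (qᵘ∣n , _) k≤μ = ∣-trans (^-monoʳ-∣ q k≤μ) qᵘ∣n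

  ^∣⇒^[k+k]∣n*n : ∀ {q n} k → q ^ k ∣ n → q ^ (k + k) ∣ n * n
  ^∣⇒^[k+k]∣n*n {q} {n} k qᵏ∣n = subst (_∣ n * n) (sym (^-distribˡ-+-* q k k)) (*-pres-∣ qᵏ∣n qᵏ∣n)

  hasOrd-suc⇒∣ : ∀ {q n k} → HasOrd q n (suc k) → q ∣ n
  hasOrd-suc⇒∣ {q} {k = k} (qᵏ⁺¹∣n , _) = ∣-trans (m∣m*n (q ^ k)) qᵏ⁺¹∣n

  hasOrd-^ : ∀ {q} → Prime q → ∀ k → HasOrd q (q ^ k) k
  hasOrd-^ {q} pq k = ∣-refl , λ qᵏ⁺¹∣qᵏ → <⇒≱ qᵏ<qᵏ⁺¹ (∣⇒≤ qᵏ⁺¹∣qᵏ)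
    where
    instance
      _ = prime⇒nonZero pq
      _ = m^n≢0 q k
    qᵏ<qᵏ⁺¹ : q ^ k < q ^ suc k
    qᵏ<qᵏ⁺¹ = subst (q ^ k <_) (*-comm (q ^ k) q)
      (m<m*n (q ^ k) q (nonTrivial⇒n>1 q {{prime⇒nonTrivial pq}}))

  hasOrd-exists : ∀ {q n} → Prime q → 0 < n → ∃ (HasOrd q n)
  hasOrd-exists {q} pq = go (<-wellFounded _)
    where
    instance _ = prime⇒nonTrivial pq
    go : ∀ {n} → Acc _<_ n → 0 < n → ∃ (HasOrd q n)
    go {n} (acc rs) n>0 with q ∣? n
    ... | no q∤n = 0 , ∤⇒hasOrd-0 q∤n
    ... | yes q∣n@(divides m n≡mq) =
      let instance _ = >-nonZero n>0
          m>0 = >-nonZero⁻¹ m {{quotient≢0 q∣n}}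
          (k , qᵏ∣m , qᵏ⁺¹∤m) = go (rs (quotient-< q∣n)) m>0
          n≡qm = trans n≡mq (*-comm m q)
      in suc k
       , subst (q ^ suc k ∣_) (sym n≡qm) (*-monoʳ-∣ q qᵏ∣m)
       , λ qᵏ⁺²∣n → qᵏ⁺¹∤m (*-cancelˡ-∣ q {{prime⇒nonZero pq}}
                              (subst (q ^ suc (suc k) ∣_) n≡qm qᵏ⁺²∣n))

  hasOrd-* : ∀ {q m n a b} → Prime q → HasOrd q m a → HasOrd q n b → HasOrd q (m * n) (a + b)
  hasOrd-* {q} {m} {n} {a} {b} pq (divides m′ m≡m′qᵃ , qᵃ⁺¹∤m) (divides n′ n≡n′qᵇ , qᵇ⁺¹∤n) =
    divides (m′ * n′) mn≡ , qᵃ⁺ᵇ⁺¹∤mn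
    where
    instance
      _ = prime⇒nonZero pq
      _ = m^n≢0 q (a + b)
    mn≡ : m * n ≡ m′ * n′ * q ^ (a + b)
    mn≡ = begin
      m * n                        ≡⟨ cong₂ _*_ m≡m′qᵃ n≡n′qᵇ ⟩
      (m′ * q ^ a) * (n′ * q ^ b)  ≡⟨ *-interchange m′ (q ^ a) n′ (q ^ b) ⟩
      m′ * n′ * (q ^ a * q ^ b)    ≡⟨ cong (m′ * n′ *_) (^-distribˡ-+-* q a b) ⟨
      m′ * n′ * q ^ (a + b)        ∎
      where open ≡-Reasoning
    qᵃ⁺ᵇ⁺¹∤mn : ¬ q ^ suc (a + b) ∣ m * n
    qᵃ⁺ᵇ⁺¹∤mn h with euclidsLemma m′ n′ pq
                       (*-cancelʳ-∣ (q ^ (a + b)) (subst (q ^ suc (a + b) ∣_) mn≡ h))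
    ... | inj₁ q∣m′ = qᵃ⁺¹∤m (subst (q * q ^ a ∣_) (sym m≡m′qᵃ) (*-monoˡ-∣ (q ^ a) q∣m′))
    ... | inj₂ q∣n′ = qᵇ⁺¹∤n (subst (q * q ^ b ∣_) (sym n≡n′qᵇ) (*-monoˡ-∣ (q ^ b) q∣n′))

  hasOrd-cube : ∀ {q n e} → Prime q → HasOrd q n e → HasOrd q (n * n * n) (3 * e)
  hasOrd-cube {q} {n} {e} pq h =
    subst (HasOrd q (n * n * n)) e+e+e≡3*e
      (hasOrd-* {a = e + e} pq (hasOrd-* {a = e} {b = e} pq h h) h)
    where
    e+e+e≡3*e : e + e + e ≡ 3 * e
    e+e+e≡3*e = trans (+-assoc e e e) (cong (λ k → e + (e + k)) (sym (+-identityʳ e)))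

  hasOrd-+ : ∀ {q m n μ} → q ^ suc μ ∣ m → HasOrd q n μ → HasOrd q (m + n) μ
  hasOrd-+ {q} {μ = μ} qᵘ⁺¹∣m (qᵘ∣n , qᵘ⁺¹∤n) =
    ∣m∣n⇒∣m+n (∣-trans (^-monoʳ-∣ q (n≤1+n μ)) qᵘ⁺¹∣m) qᵘ∣n ,
    λ qᵘ⁺¹∣m+n → qᵘ⁺¹∤n (∣m+n∣m⇒∣n qᵘ⁺¹∣m+n qᵘ⁺¹∣m)

  hasOrd-*-cancelˡ : ∀ {q m n k l} → Prime q → 0 < n →
    HasOrd q m k → HasOrd q (m * n) (k + l) → HasOrd q n l
  hasOrd-*-cancelˡ {q} {n = n} {k} {l} pq n>0 hm hmn =
    let (l′ , hn) = hasOrd-exists pq n>0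
    in subst (HasOrd q n) (+-cancelˡ-≡ k l′ l (hasOrd-unique (hasOrd-* {a = k} pq hm hn) hmn)) hn

  prime∤1 : ∀ {q} → Prime q → ¬ q ∣ 1
  prime∤1 pq q∣1 = ¬prime[1] (subst Prime (∣1⇒≡1 q∣1) pq)

  prime∣2⇒≡2 : ∀ {q} → Prime q → q ∣ 2 → q ≡ 2
  prime∣2⇒≡2 pq q∣2 with irreducible[2] q∣2
  ... | inj₁ q≡1 = contradiction (subst Prime q≡1 pq) ¬prime[1]
  ... | inj₂ q≡2 = q≡2

  prime≢2⇒∤2^ : ∀ {q} → Prime q → q ≢ 2 → ∀ k → ¬ q ∣ 2 ^ k
  prime≢2⇒∤2^ pq q≢2 zero    = prime∤1 pq
  prime≢2⇒∤2^ pq q≢2 (suc k) q∣2ᵏ⁺¹ with euclidsLemma 2 (2 ^ k) pq q∣2ᵏ⁺¹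
  ... | inj₁ q∣2  = q≢2 (prime∣2⇒≡2 pq q∣2)
  ... | inj₂ q∣2ᵏ = prime≢2⇒∤2^ pq q≢2 k q∣2ᵏ

  hasOrd-2-odd-prime : ∀ {q} → Prime q → q ≢ 2 → HasOrd q 2 0
  hasOrd-2-odd-prime pq q≢2 = ∤⇒hasOrd-0 (prime≢2⇒∤2^ pq q≢2 1)

module Residue where

  open import Data.Nat
  open import Data.Nat.Properties using (+-identityʳ)
  open import Data.Nat.DivMod
  open import Data.Nat.Tactic.RingSolver using (solve-∀)
  open import Data.Product
  open import Data.Sum
  open import Relation.Binary.PropositionalEquality

  [m%n+o]%n≡[m+o]%n : ∀ m o n .{{_ : NonZero n}} → (m % n + o) % n ≡ (m + o) % n
  [m%n+o]%n≡[m+o]%n m o n = begin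
    (m % n + o) % n          ≡⟨ %-distribˡ-+ (m % n) o n ⟩
    (m % n % n + o % n) % n  ≡⟨ cong (λ k → (k + o % n) % n) (m%n%n≡m%n m n) ⟩
    (m % n + o % n) % n      ≡⟨ %-distribˡ-+ m o n ⟨
    (m + o) % n              ∎
    where open ≡-Reasoning

  -- (t + 2 * r) % 3 is (t − r) mod 3 without truncated subtraction.
  %3-solve : ∀ r s t → (r + s) % 3 ≡ t % 3 → s % 3 ≡ (t + 2 * r) % 3
  %3-solve r s t r+s≡t = begin
    s % 3                      ≡⟨ [m+kn]%n≡m%n s r 3 ⟨
    (s + r * 3) % 3            ≡⟨ cong (_% 3) (s+3r≡r+s+2r r s) ⟩
    (r + s + 2 * r) % 3        ≡⟨ [m%n+o]%n≡[m+o]%n (r + s) (2 * r) 3 ⟨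
    ((r + s) % 3 + 2 * r) % 3  ≡⟨ cong (λ k → (k + 2 * r) % 3) r+s≡t ⟩
    (t % 3 + 2 * r) % 3        ≡⟨ [m%n+o]%n≡[m+o]%n t (2 * r) 3 ⟩
    (t + 2 * r) % 3            ∎
    where
    open ≡-Reasoning
    s+3r≡r+s+2r : ∀ r s → s + r * 3 ≡ r + s + 2 * r
    s+3r≡r+s+2r = solve-∀

  residue≡⇒≤ : ∀ {a r} → a % 3 ≡ r → r ≤ a
  residue≡⇒≤ {a} a%3≡r = subst (_≤ a) a%3≡r (m%n≤m a 3)

  %3-solve-residue : ∀ a b t → (a + b) % 3 ≡ t % 3 → b % 3 ≡ (t + 2 * (a % 3)) % 3
  %3-solve-residue a b t a+b≡t = %3-solve (a % 3) b t (trans ([m%n+o]%n≡[m+o]%n a b 3) a+b≡t)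

  residues-sum≡1 : ∀ a b → (a + b) % 3 ≡ 1 →
    (a % 3 ≡ 1 × b % 3 ≡ 0) ⊎ (a % 3 ≡ 0 × b % 3 ≡ 1) ⊎ (a % 3 ≡ 2 × b % 3 ≡ 2)
  residues-sum≡1 a b a+b≡1 with a % 3 | %3-solve-residue a b 1 a+b≡1 | m%n<n a 3
  ... | 0 | b≡1 | _ = inj₂ (inj₁ (refl , b≡1))
  ... | 1 | b≡0 | _ = inj₁ (refl , b≡0)
  ... | 2 | b≡2 | _ = inj₂ (inj₂ (refl , b≡2))
  ... | suc (suc (suc _)) | _ | s≤s (s≤s (s≤s ()))

  residues-sum≡0 : ∀ a b → (a + b) % 3 ≡ 0 →
    (a % 3 ≡ 0 × b % 3 ≡ 0) ⊎ (a % 3 ≡ 1 × b % 3 ≡ 2) ⊎ (a % 3 ≡ 2 × b % 3 ≡ 1)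
  residues-sum≡0 a b a+b≡0 with a % 3 | %3-solve-residue a b 0 a+b≡0 | m%n<n a 3
  ... | 0 | b≡0 | _ = inj₁ (refl , b≡0)
  ... | 1 | b≡2 | _ = inj₂ (inj₁ (refl , b≡2))
  ... | 2 | b≡1 | _ = inj₂ (inj₂ (refl , b≡1))
  ... | suc (suc (suc _)) | _ | s≤s (s≤s (s≤s ()))

  residues-with-zero : ∀ c {a b} → a ≡ 0 ⊎ b ≡ 0 → (c + a + b) % 3 ≡ 0 →
    (a % 3 ≡ (2 * c) % 3 × b % 3 ≡ 0) ⊎ (a % 3 ≡ 0 × b % 3 ≡ (2 * c) % 3)
  residues-with-zero c {b = b} (inj₁ refl) c+b≡0 =
    inj₂ (refl , %3-solve c b 0 (trans (cong (λ k → (k + b) % 3) (sym (+-identityʳ c))) c+b≡0))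
  residues-with-zero c {a = a} (inj₂ refl) c+a≡0 =
    inj₁ (%3-solve c a 0 (trans (cong (_% 3) (sym (+-identityʳ (c + a)))) c+a≡0) , refl)

module SquareMinusOne where

  open import Defs
  open import Data.Nat
  open import Data.Nat.Properties
  open import Data.Nat.Divisibility
  open import Data.Nat.Coprimality using (Coprime)
  open import Data.Nat.Tactic.RingSolver using (solve-∀)
  open import Data.Product
  open import Data.Sum
  open import Relation.Nullary using (¬_; contradiction)
  open import Relation.Binary.PropositionalEquality

  even-or-odd : ∀ n → 2 ∣ n ⊎ ∃ λ k → n ≡ 1 + k * 2
  even-or-odd zero          = inj₁ (divides 0 refl)
  even-or-odd (suc zero)    = inj₂ (0 , refl)
  even-or-odd (suc (suc n)) with even-or-odd n
  ... | inj₁ (divides k n≡2k) = inj₁ (divides (suc k) (cong (2 +_) n≡2k))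
  ... | inj₂ (k , n≡1+2k)     = inj₂ (suc k , cong (2 +_) n≡1+2k)

  2∣n*[n+1] : ∀ n → 2 ∣ n * (n + 1)
  2∣n*[n+1] n with even-or-odd n
  ... | inj₁ 2∣n          = ∣m⇒∣m*n (n + 1) 2∣n
  ... | inj₂ (k , n≡1+2k) =
    ∣n⇒∣m*n n (divides (suc k) (trans (cong (_+ 1) n≡1+2k) (+-comm (1 + k * 2) 1)))

  dsq-1+1 : ∀ {d} → 1 ≤ d → d * d ≡ dsq-1 d + 1
  dsq-1+1 {suc d} _ = sym (m∸n+n≡m {suc d * suc d} {1} (s≤s z≤n))

  dsq-1>0 : ∀ {d} → 2 ≤ d → 0 < dsq-1 d
  dsq-1>0 {suc (suc d)} _ = s≤s z≤n
  dsq-1>0 {suc zero} (s≤s ())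

  4B≡s+dsq-1⇒B>0 : ∀ {d B s} → 2 ≤ d → 4 * B ≡ s + dsq-1 d → 0 < B
  4B≡s+dsq-1⇒B>0 {B = suc _} _   _       = s≤s z≤n
  4B≡s+dsq-1⇒B>0 {d} {zero} {s} d≥2 0≡s+D =
    contradiction 0≡s+D (<⇒≢ (<-≤-trans (dsq-1>0 d≥2) (m≤n+m (dsq-1 d) s)))

  coprime-dsq-1 : ∀ {d} → 1 ≤ d → Coprime d (dsq-1 d)
  coprime-dsq-1 {d} d≥1 {m} (m∣d , m∣D) =
    ∣1⇒≡1 (∣m+n∣m⇒∣n (subst (m ∣_) (dsq-1+1 d≥1) (∣m⇒∣m*n d m∣d)) m∣D)

  odd⇒8∣dsq-1 : ∀ {d} → ¬ 2 ∣ d → 8 ∣ dsq-1 d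
  odd⇒8∣dsq-1 {d} 2∤d with even-or-odd d
  ... | inj₁ 2∣d        = contradiction 2∣d 2∤d
  ... | inj₂ (k , refl) = subst (8 ∣_) (sym D≡4k[k+1]) (*-monoʳ-∣ 4 (2∣n*[n+1] k))
    where
    square : ∀ k → (1 + k * 2) * (1 + k * 2) ≡ 4 * (k * (k + 1)) + 1
    square = solve-∀
    D≡4k[k+1] : dsq-1 (1 + k * 2) ≡ 4 * (k * (k + 1))
    D≡4k[k+1] = trans (cong (_∸ 1) (square k)) (m+n∸n≡m _ 1)

module CubeCondition where

  open import Defs
  open import Data.Nat
  open import Data.Nat.Properties
  open import Data.Nat.Divisibility
  open import Data.Nat.DivMod using (%-remove-+ʳ)
  open import Data.Nat.Primality
  open import Data.Product
  open import Data.Sum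
  open import Relation.Nullary using (¬_; yes; no; contradiction)
  open import Relation.Binary.PropositionalEquality
  open import Function using (_∘_)
  open Valuation
  open Residue
  open SquareMinusOne

  -- A′ stands for |L| and A for α: they coincide unless L = 0, where A′ = 0.
  module _ {d A A′ B Y : ℕ} (d≥3 : 3 ≤ d) (A>0 : 0 < A) (B>0 : 0 < B)
           (dAB≡2Y³ : d * A * B ≡ 2 * (Y * Y * Y))
           (A∣A′ : A ∣ A′) (4B≡A′²+D : 4 * B ≡ A′ * A′ + dsq-1 d) where

    D : ℕ
    D = dsq-1 d

    private
      d≥1 : 1 ≤ d
      d≥1 = ≤-trans (s≤s z≤n) d≥3

      D>0 : 0 < D
      D>0 = dsq-1>0 (≤-trans (n≤1+n 2) d≥3)

      Y>0 : 0 < Y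
      Y>0 = n≢0⇒n>0 λ Y≡0 → ≢-nonZero⁻¹ (d * A * B)
          (trans dAB≡2Y³ (cong (λ y → 2 * (y * y * y)) Y≡0))
        where
        instance
          _ = >-nonZero d≥1
          _ = >-nonZero A>0
          _ = >-nonZero B>0
          _ = m*n≢0 d A
          _ = m*n≢0 (d * A) B

    prime∤d∧dsq-1 : ∀ {q} → Prime q → q ∣ d → ¬ q ∣ D
    prime∤d∧dsq-1 pq q∣d q∣D = ¬prime[1] (subst Prime (coprime-dsq-1 d≥1 (q∣d , q∣D)) pq)

    ∣A⇒∣4B⇒∣dsq-1 : ∀ {q} → q ∣ A → q ∣ 4 * B → q ∣ D
    ∣A⇒∣4B⇒∣dsq-1 {q} q∣A q∣4B =
      ∣m+n∣m⇒∣n (subst (q ∣_) 4B≡A′²+D q∣4B) (∣m⇒∣m*n A′ (∣-trans q∣A A∣A′))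

    -- ord_q(A′²) > ord_q D, so 4B = A′² + D has the valuation of D.
    hasOrd-B : ∀ {q k μ} → Prime q → HasOrd q 4 k → HasOrd q D (k + μ) →
      q ^ suc (k + μ) ∣ A′ * A′ → HasOrd q B μ
    hasOrd-B {q} {k} {μ} pq h4 hD qᵏ⁺ᵘ⁺¹∣A′² = hasOrd-*-cancelˡ {k = k} {l = μ} pq B>0 h4
      (subst (λ n → HasOrd q n (k + μ)) (sym 4B≡A′²+D) (hasOrd-+ {μ = k + μ} qᵏ⁺ᵘ⁺¹∣A′² hD))

    valuation-zero : ∀ {q} a b → ¬ q ∣ D → HasOrd q A a → HasOrd q B b → a ≡ 0 ⊎ b ≡ 0
    valuation-zero zero     _        _   _  _  = inj₁ refl
    valuation-zero (suc _)  zero     _   _  _  = inj₂ refl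
    valuation-zero (suc a′) (suc b′) q∤D ha hb =
      contradiction (∣A⇒∣4B⇒∣dsq-1 (hasOrd-suc⇒∣ {k = a′} ha) (∣n⇒∣m*n 4 (hasOrd-suc⇒∣ {k = b′} hb)))
        q∤D

    valuation-congruence : ∀ {q} c o a b → Prime q → HasOrd q d c → HasOrd q 2 o →
      HasOrd q A a → HasOrd q B b → (c + a + b) % 3 ≡ o % 3
    valuation-congruence {q} c o a b pq hc ho ha hb = begin
      (c + a + b) % 3    ≡⟨ cong (_% 3) (hasOrd-unique {a = c + a + b} {b = o + 3 * e} hdAB h2Y³) ⟩
      (o + 3 * e) % 3    ≡⟨ %-remove-+ʳ o (m∣m*n e) ⟩
      o % 3              ∎
      where
      open ≡-Reasoning
      e = proj₁ (hasOrd-exists pq Y>0)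
      he : HasOrd q Y e
      he = proj₂ (hasOrd-exists pq Y>0)
      hdAB : HasOrd q (d * A * B) (c + a + b)
      hdAB = hasOrd-* {a = c + a} pq (hasOrd-* {a = c} pq hc ha) hb
      h2Y³ : HasOrd q (d * A * B) (o + 3 * e)
      h2Y³ = subst (λ n → HasOrd q n (o + 3 * e)) (sym dAB≡2Y³)
        (hasOrd-* {a = o} pq ho (hasOrd-cube {e = e} pq he))

    congruence-∤d : ∀ {q} o a b → Prime q → ¬ q ∣ d → HasOrd q 2 o →
      HasOrd q A a → HasOrd q B b → (a + b) % 3 ≡ o % 3
    congruence-∤d o a b pq q∤d = valuation-congruence 0 o a b pq (∤⇒hasOrd-0 q∤d)

    inT-coprime : ∀ {q} a b → Prime q → q ≢ 2 → ¬ q ∣ d → ¬ q ∣ D →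
      HasOrd q A a → HasOrd q B b → InT d q (a % 3) (b % 3)
    inT-coprime a b pq q≢2 q∤d q∤D ha hb = inj₁ ([ q∤d , q∤D ]′ ∘ euclidsLemma d D pq ,
      reduce (residues-with-zero 0 (valuation-zero a b q∤D ha hb)
        (congruence-∤d 0 a b pq q∤d (hasOrd-2-odd-prime pq q≢2) ha hb)))

    2∣d⇒2∤A : 2 ∣ d → ¬ 2 ∣ A
    2∣d⇒2∤A 2∣d 2∣A = prime∤d∧dsq-1 prime[2] 2∣d (∣A⇒∣4B⇒∣dsq-1 2∣A (∣m⇒∣m*n B (divides 2 refl)))

    inT-2∣d : ∀ a b → 2 ∣ d → HasOrd 2 A a → HasOrd 2 B b → InT d 2 (a % 3) (b % 3)
    inT-2∣d a b 2∣d ha hb with hasOrd-unique {a = a} {b = 0} ha (∤⇒hasOrd-0 (2∣d⇒2∤A 2∣d))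
    ... | refl = inj₂ (inj₁ (refl , 2∣d , c , hc , refl , %3-solve c b 1 c+b≡1))
      where
      c = proj₁ (hasOrd-exists prime[2] d≥1)
      hc : HasOrd 2 d c
      hc = proj₂ (hasOrd-exists prime[2] d≥1)
      c+b≡1 : (c + b) % 3 ≡ 1
      c+b≡1 = trans (cong (λ k → (k + b) % 3) (sym (+-identityʳ c)))
        (valuation-congruence c 1 0 b prime[2] hc (hasOrd-^ prime[2] 1) ha hb)

    inT-2∤d : ∀ a b → ¬ 2 ∣ d → HasOrd 2 A a → HasOrd 2 B b → InT d 2 (a % 3) (b % 3)
    inT-2∤d a b 2∤d ha hb = classify (hasOrd-exists prime[2] D>0)
      where
      a+b≡1 : (a + b) % 3 ≡ 1
      a+b≡1 = congruence-∤d 1 a b prime[2] 2∤d (hasOrd-^ prime[2] 1) ha hb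
      classify : ∃ (HasOrd 2 D) → InT d 2 (a % 3) (b % 3)
      classify (μ , hμ) with m≤n⇒m<n∨m≡n (^∣⇒≤hasOrd {k = 3} hμ (odd⇒8∣dsq-1 2∤d))
      ... | inj₁ μ≥4 =
        inj₂ (inj₂ (inj₁ (refl , 2∤d , μ , hμ , μ≥4 , residues-sum≡1 a b a+b≡1)))
      ... | inj₂ refl =
        inj₂ (inj₂ (inj₂ (inj₁ (refl , 2∤d , hμ , exclude (residues-sum≡1 a b a+b≡1)))))
        where
        exclude : (a % 3 ≡ 1 × b % 3 ≡ 0) ⊎ (a % 3 ≡ 0 × b % 3 ≡ 1) ⊎ (a % 3 ≡ 2 × b % 3 ≡ 2) →
          (a % 3 ≡ 1 × b % 3 ≡ 0) ⊎ (a % 3 ≡ 0 × b % 3 ≡ 1)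
        exclude (inj₁ r)               = inj₁ r
        exclude (inj₂ (inj₁ r))        = inj₂ r
        exclude (inj₂ (inj₂ (a≡2 , b≡2))) = contradiction (trans (sym b≡2) (cong (_% 3) b≡1)) λ ()
          where
          b≡1 : b ≡ 1
          b≡1 = hasOrd-unique {b = 1} hb
            (hasOrd-B {k = 2} {μ = 1} prime[2] (hasOrd-^ prime[2] 2) hμ
              (^∣⇒^[k+k]∣n*n {q = 2} 2 (∣-trans (hasOrd⇒^∣ {μ = a} ha (residue≡⇒≤ a≡2)) A∣A′)))

    inT-∣d : ∀ {q} a b → Prime q → q ≢ 2 → q ∣ d →
      HasOrd q A a → HasOrd q B b → InT d q (a % 3) (b % 3)
    inT-∣d {q} a b pq q≢2 q∣d ha hb = inj₂ (inj₂ (inj₂ (inj₂ (inj₁ (q≢2 , q∣d , c , hc ,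
      residues-with-zero c (valuation-zero a b (prime∤d∧dsq-1 pq q∣d) ha hb)
        (valuation-congruence c 0 a b pq hc (hasOrd-2-odd-prime pq q≢2) ha hb))))))
      where
      c = proj₁ (hasOrd-exists pq d≥1)
      hc : HasOrd q d c
      hc = proj₂ (hasOrd-exists pq d≥1)

    inT-∣dsq-1 : ∀ {q} a b → Prime q → q ≢ 2 → q ∣ D →
      HasOrd q A a → HasOrd q B b → InT d q (a % 3) (b % 3)
    inT-∣dsq-1 {q} a b pq q≢2 q∣D ha hb = classify (hasOrd-exists pq D>0)
      where
      a+b≡0 : (a + b) % 3 ≡ 0
      a+b≡0 = congruence-∤d 0 a b pq (λ q∣d → prime∤d∧dsq-1 pq q∣d q∣D)
        (hasOrd-2-odd-prime pq q≢2) ha hb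
      classify : ∃ (HasOrd q D) → InT d q (a % 3) (b % 3)
      classify (μ , hμ)
        with m≤n⇒m<n∨m≡n (^∣⇒≤hasOrd {k = 1} hμ (∣-trans (∣-reflexive (*-identityʳ q)) q∣D))
      ... | inj₁ μ≥2 =
        inj₂ (inj₂ (inj₂ (inj₂ (inj₂ (inj₁ (q≢2 , q∣D , μ , hμ , μ≥2 , residues-sum≡0 a b a+b≡0))))))
      ... | inj₂ refl =
        inj₂ (inj₂ (inj₂ (inj₂ (inj₂ (inj₂ (q≢2 , hμ , exclude (residues-sum≡0 a b a+b≡0)))))))
        where
        exclude : (a % 3 ≡ 0 × b % 3 ≡ 0) ⊎ (a % 3 ≡ 1 × b % 3 ≡ 2) ⊎ (a % 3 ≡ 2 × b % 3 ≡ 1) →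
          (a % 3 ≡ 0 × b % 3 ≡ 0) ⊎ (a % 3 ≡ 2 × b % 3 ≡ 1)
        exclude (inj₁ r)               = inj₁ r
        exclude (inj₂ (inj₂ r))        = inj₂ r
        exclude (inj₂ (inj₁ (a≡1 , b≡2))) = contradiction (trans (sym b≡2) (cong (_% 3) b≡1)) λ ()
          where
          b≡1 : b ≡ 1
          b≡1 = hasOrd-unique {b = 1} hb
            (hasOrd-B {k = 0} {μ = 1} pq (∤⇒hasOrd-0 (prime≢2⇒∤2^ pq q≢2 2)) hμ
              (^∣⇒^[k+k]∣n*n {q = q} 1 (∣-trans (hasOrd⇒^∣ {μ = a} ha (residue≡⇒≤ a≡1)) A∣A′)))

    inA : InA d A B
    inA = A>0 , B>0 , inT
      where
      inT : ∀ q → Prime q → ∀ a b → HasOrd q A a → HasOrd q B b → InT d q (a % 3) (b % 3)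
      inT q pq a b ha hb with q ≟ 2
      inT q pq a b ha hb | yes refl with 2 ∣? d
      ... | yes 2∣d = inT-2∣d a b 2∣d ha hb
      ... | no 2∤d  = inT-2∤d a b 2∤d ha hb
      inT q pq a b ha hb | no q≢2 with q ∣? d | q ∣? D
      ... | yes q∣d | _       = inT-∣d a b pq q≢2 q∣d ha hb
      ... | no q∤d  | yes q∣D = inT-∣dsq-1 a b pq q≢2 q∣D ha hb
      ... | no q∤d  | no q∤D  = inT-coprime a b pq q≢2 q∤d q∤D ha hb

module Quadratic where

  open import Defs
  open import Data.Nat as ℕ using (ℕ; zero; suc; _≤_; _<_; s≤s; z≤n)
  import Data.Nat.Properties as ℕ
  open import Data.Nat.DivMod using (m*[n/m]≡n)
  open import Data.Integer using (ℤ; +_; -[1+_]; _*_; _+_; _-_; ∣_∣)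
  import Data.Integer.Properties as ℤ
  open import Data.Nat.Divisibility using (_∣0; ∣-refl)
  open import Data.Integer.Tactic.RingSolver using (solve-∀)
  open import Data.Nat.Tactic.RingSolver using () renaming (solve-∀ to ℕ-solve-∀)
  open import Data.Product
  open import Relation.Binary.PropositionalEquality
  open SquareMinusOne
  open CubeCondition using (inA)

  i*i≡+∣i∣*∣i∣ : ∀ i → i * i ≡ + (∣ i ∣ ℕ.* ∣ i ∣)
  i*i≡+∣i∣*∣i∣ (+ n)     = sym (ℤ.pos-* n n)
  i*i≡+∣i∣*∣i∣ -[1+ n ] = refl

  4Q≡L²+dsq-1 : ∀ {d} → 1 ≤ d → ∀ x → + 4 * Q d x ≡ L d x * L d x + + dsq-1 d
  4Q≡L²+dsq-1 {d} d≥1 x = begin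
    + 4 * Q d x                                         ≡⟨ expand x δ H ⟩
    L² + + 2 * (+ 2 * H) - (δ + + 1) * (δ + + 1)
      ≡⟨ cong (λ h → L² + + 2 * h - (δ + + 1) * (δ + + 1)) 2H≡δ[δ+1] ⟩
    L² + + 2 * (δ * (δ + + 1)) - (δ + + 1) * (δ + + 1)  ≡⟨ collapse L² δ ⟩
    L² + δ * δ - + 1                                    ≡⟨ cong (λ s → L² + s - + 1) δ²≡D+1 ⟩
    L² + (+ dsq-1 d + + 1) - + 1                        ≡⟨ cancel L² (+ dsq-1 d) ⟩
    L² + + dsq-1 d                                      ∎
    where
    open ≡-Reasoning
    δ H L² : ℤ
    δ  = + d
    H  = + (d ℕ.* (d ℕ.+ 1) ℕ./ 2)
    L² = L d x * L d x
    expand : ∀ x δ H → + 4 * (x * x + (δ + + 1) * x + H)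
      ≡ (+ 2 * x + δ + + 1) * (+ 2 * x + δ + + 1) + + 2 * (+ 2 * H) - (δ + + 1) * (δ + + 1)
    expand = solve-∀
    collapse : ∀ s δ → s + + 2 * (δ * (δ + + 1)) - (δ + + 1) * (δ + + 1) ≡ s + δ * δ - + 1
    collapse = solve-∀
    cancel : ∀ s t → s + (t + + 1) - + 1 ≡ s + t
    cancel = solve-∀
    2H≡δ[δ+1] : + 2 * H ≡ δ * (δ + + 1)
    2H≡δ[δ+1] = begin
      + 2 * H                                 ≡⟨ ℤ.pos-* 2 (d ℕ.* (d ℕ.+ 1) ℕ./ 2) ⟨
      + (2 ℕ.* (d ℕ.* (d ℕ.+ 1) ℕ./ 2))       ≡⟨ cong +_ (m*[n/m]≡n (2∣n*[n+1] d)) ⟩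
      + (d ℕ.* (d ℕ.+ 1))                     ≡⟨ ℤ.pos-* d (d ℕ.+ 1) ⟩
      δ * (δ + + 1)                           ∎
    δ²≡D+1 : δ * δ ≡ + dsq-1 d + + 1
    δ²≡D+1 = trans (sym (ℤ.pos-* d d)) (cong +_ (dsq-1+1 d≥1))

  abs-cube-equation : ∀ d ℓ B y → + d * ℓ * + B ≡ + 2 * (y * y * y) →
    d ℕ.* ∣ ℓ ∣ ℕ.* B ≡ 2 ℕ.* (∣ y ∣ ℕ.* ∣ y ∣ ℕ.* ∣ y ∣)
  abs-cube-equation d ℓ B y dℓB≡2y³ = begin
    d ℕ.* ∣ ℓ ∣ ℕ.* B                 ≡⟨ cong (ℕ._* B) (ℤ.abs-* (+ d) ℓ) ⟨
    ∣ + d * ℓ ∣ ℕ.* B                 ≡⟨ ℤ.abs-* (+ d * ℓ) (+ B) ⟨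
    ∣ + d * ℓ * + B ∣                 ≡⟨ cong ∣_∣ dℓB≡2y³ ⟩
    ∣ + 2 * (y * y * y) ∣             ≡⟨ ℤ.abs-* (+ 2) (y * y * y) ⟩
    2 ℕ.* ∣ y * y * y ∣               ≡⟨ cong (2 ℕ.*_) (ℤ.abs-* (y * y) y) ⟩
    2 ℕ.* (∣ y * y ∣ ℕ.* ∣ y ∣)       ≡⟨ cong (λ n → 2 ℕ.* (n ℕ.* ∣ y ∣)) (ℤ.abs-* y y) ⟩
    2 ℕ.* (∣ y ∣ ℕ.* ∣ y ∣ ℕ.* ∣ y ∣) ∎
    where open ≡-Reasoning

  +4*i≡+n⇒nonNegative : ∀ i {n} → + 4 * i ≡ + n → ∃ λ m → i ≡ + m × 4 ℕ.* m ≡ n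
  +4*i≡+n⇒nonNegative (+ m)     4m≡n = m , refl , ℤ.+-injective (trans (ℤ.pos-* 4 m) 4m≡n)
  +4*i≡+n⇒nonNegative -[1+ _ ] ()

  Q-natural : ∀ {d} → 1 ≤ d → ∀ x →
    ∃ λ B → Q d x ≡ + B × 4 ℕ.* B ≡ ∣ L d x ∣ ℕ.* ∣ L d x ∣ ℕ.+ dsq-1 d
  Q-natural {d} d≥1 x = +4*i≡+n⇒nonNegative (Q d x)
    (trans (4Q≡L²+dsq-1 d≥1 x) (cong (_+ + dsq-1 d) (i*i≡+∣i∣*∣i∣ (L d x))))

  -- For ℓ = 0 any α will do since y₁ = 0; this one makes d α B = 2 (d B)³ twice a cube again.
  L-decomposition : ∀ {d B} Y → 3 ≤ d → 0 < B → ∀ ℓ →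
    d ℕ.* ∣ ℓ ∣ ℕ.* B ≡ 2 ℕ.* (Y ℕ.* Y ℕ.* Y) → 4 ℕ.* B ≡ ∣ ℓ ∣ ℕ.* ∣ ℓ ∣ ℕ.+ dsq-1 d →
    ∃ λ y₁ → ∃ λ α → InA d α B × ℓ ≡ + α * (y₁ * y₁ * y₁)
  L-decomposition {d} {B} _ d≥3 B>0 (+ zero) _ 4B≡D =
    + 0 , α ,
    inA {Y = d ℕ.* B} d≥3 (α>0 (ℕ.≤-trans (s≤s z≤n) d≥3) B>0) B>0 (dαB≡2[dB]³ d B) (α ∣0) 4B≡D ,
    sym (ℤ.*-zeroʳ (+ α))
    where
    α = 2 ℕ.* d ℕ.* d ℕ.* B ℕ.* B
    α>0 : ∀ {d B} → 0 < d → 0 < B → 0 < 2 ℕ.* d ℕ.* d ℕ.* B ℕ.* B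
    α>0 {suc _} {suc _} _ _ = s≤s z≤n
    dαB≡2[dB]³ : ∀ d B →
      d ℕ.* (2 ℕ.* d ℕ.* d ℕ.* B ℕ.* B) ℕ.* B ≡ 2 ℕ.* (d ℕ.* B ℕ.* (d ℕ.* B) ℕ.* (d ℕ.* B))
    dαB≡2[dB]³ = ℕ-solve-∀
  L-decomposition Y d≥3 B>0 (+ suc n) dℓB≡2Y³ 4B≡ℓ²+D =
    + 1 , suc n , inA {Y = Y} d≥3 (s≤s z≤n) B>0 dℓB≡2Y³ ∣-refl 4B≡ℓ²+D ,
    sym (ℤ.*-identityʳ (+ suc n))
  L-decomposition Y d≥3 B>0 -[1+ n ] dℓB≡2Y³ 4B≡ℓ²+D =
    -[1+ 0 ] , suc n , inA {Y = Y} d≥3 (s≤s z≤n) B>0 dℓB≡2Y³ ∣-refl 4B≡ℓ²+D ,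
    cong -[1+_] (sym (ℕ.*-identityʳ n))


open import Defs
open import Data.Nat using (ℕ; _≤_)
open import Data.Integer using (ℤ; +_; _*_)
open import Data.Product using (_×_; ∃)
open import Relation.Binary.PropositionalEquality using (_≡_)

open import Data.Nat using (s≤s; z≤n)
open import Data.Nat.Properties using (≤-trans; n≤1+n)
open import Data.Integer using (∣_∣)
open import Data.Integer.Properties using (*-identityʳ)
open import Data.Product using (_,_)
open import Relation.Binary.PropositionalEquality using (subst; trans; sym)
open SquareMinusOne using (4B≡s+dsq-1⇒B>0)
open Quadratic using (Q-natural; abs-cube-equation; L-decomposition)

lemma8p1 : (d : ℕ) → 3 ≤ d → (x y : ℤ) →
    + d * L d x * Q d x ≡ + 2 * (y * y * y) →
    ∃ λ (y₁ : ℤ) → ∃ λ (y₂ : ℤ) → ∃ λ (α : ℕ) → ∃ λ (β : ℕ) →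
    InA d α β × L d x ≡ + α * (y₁ * y₁ * y₁) × Q d x ≡ + β * (y₂ * y₂ * y₂)
lemma8p1 d d≥3 x y dLQ≡2y³ =
  let B , Q≡B , 4B≡L²+D = Q-natural (≤-trans (s≤s z≤n) d≥3) x
      B>0 = 4B≡s+dsq-1⇒B>0 (≤-trans (n≤1+n 2) d≥3) 4B≡L²+D
      dLB≡2y³ = subst (λ q → + d * L d x * q ≡ + 2 * (y * y * y)) Q≡B dLQ≡2y³
      y₁ , α , αB∈𝒜 , L≡αy₁³ =
        L-decomposition ∣ y ∣ d≥3 B>0 (L d x) (abs-cube-equation d (L d x) B y dLB≡2y³) 4B≡L²+D
  in y₁ , + 1 , α , B , αB∈𝒜 , L≡αy₁³ , trans Q≡B (sym (*-identityʳ (+ B)))
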